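{- For $r\geq 1$ and $n\geq 0$, the number of $r$-Fubini rankings of length $n+r$ equals $\mathrm{Fub}_n^r=\sum_{k=0}^{n}(k+r)!\left\{\begin{matrix}n+r\\k+r\end{matrix}\right\}_r$.
   Context: A tuple $\beta=(b_1,\dots,b_N)\in\{1,\dots,N\}^N$ is a Fubini ranking of length $N$ if its smallest value is $1$ and for every $x$, if exactly $k>0$ entries equal $x$, the next largest value occurring in $\beta$ (if any) is $x+k$. An $r$-Fubini ranking of length $n+r$ is a Fubini ranking $(b_1,\dots,b_{n+r})$ with $|\{b_1,\dots,b_r\}|=r$. The $r$-Stirling number of the second kind $\left\{\begin{matrix}n+r\\k+r\end{matrix}\right\}_r$ is the number of partitions of $\{1,\dots,n+r\}$ into $k+r$ nonempty blocks such that $1,\dots,r$ lie in distinct blocks. -}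

module Defs where

open import Data.Nat using (ℕ; zero; suc; _+_; _*_; _!; _≤_; _<_; _≤?_; _<?_)
open import Data.Nat.Properties using () renaming (_≟_ to _≟ℕ_)
open import Data.Bool using (Bool; true; false)
open import Data.Bool.Properties using () renaming (_≟_ to _≟B_)
open import Data.Fin using (Fin; zero; suc; toℕ)
open import Data.Fin.Properties using (all?; any?) renaming (_≟_ to _≟F_)
open import Data.List using (List; []; _∷_; [_]; map; concatMap; filter; length; upTo; allFin)
open import Data.Product using (_×_; ∃)
open import Relation.Binary.PropositionalEquality using (_≡_)
open import Relation.Nullary using (Dec; ¬_)
open import Relation.Nullary.Decidable using (_×-dec_; _→-dec_)

allFuns : {A : Set} (n : ℕ) → List A → List (Fin n → A)
allFuns zero    xs = [ (λ ()) ]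
allFuns (suc n) xs =
  concatMap (λ a → map (λ f → λ { zero → a ; (suc i) → f i }) (allFuns n xs)) xs

countBy : {A : Set} {P : A → Set} → ((a : A) → Dec (P a)) → List A → ℕ
countBy P? xs = length (filter P? xs)

-- Tuples in {1,…,N}^N are functions Fin N → ℕ (position i ↦ b_{i+1})

allTuples : (N : ℕ) → List (Fin N → ℕ)
allTuples N = allFuns N (map suc (upTo N))

mult : {N : ℕ} → (Fin N → ℕ) → ℕ → ℕ
mult {N} b x = countBy (λ j → b j ≟ℕ x) (allFin N)

IsFubini : {N : ℕ} → (Fin N → ℕ) → Set
IsFubini {N} b =
  ((i : Fin N) → 1 ≤ b i) ×
  ∃ (λ i → b i ≡ 1) ×
  ((i : Fin N) →
     ∃ (λ j → b i < b j) →
       (∃ (λ j → b j ≡ b i + mult b (b i)) ×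
        ((j : Fin N) → b i < b j → b i + mult b (b i) ≤ b j)))

isFubini? : {N : ℕ} (b : Fin N → ℕ) → Dec (IsFubini b)
isFubini? b =
  all? (λ i → 1 ≤? b i) ×-dec
  any? (λ i → b i ≟ℕ 1) ×-dec
  all? (λ i → any? (λ j → b i <? b j) →-dec
     (any? (λ j → b j ≟ℕ (b i + mult b (b i))) ×-dec
      all? (λ j → (b i <? b j) →-dec (b i + mult b (b i) ≤? b j))))

IsRFubini : (n r : ℕ) → (Fin (n + r) → ℕ) → Set
IsRFubini n r b =
  IsFubini b ×
  ((i j : Fin (n + r)) → toℕ i < r → toℕ j < r → b i ≡ b j → i ≡ j)

isRFubini? : (n r : ℕ) (b : Fin (n + r) → ℕ) → Dec (IsRFubini n r b)
isRFubini? n r b =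
  isFubini? b ×-dec
  all? (λ i → all? (λ j →
    (toℕ i <? r) →-dec ((toℕ j <? r) →-dec ((b i ≟ℕ b j) →-dec (i ≟F j)))))

numRFubini : (n r : ℕ) → ℕ
numRFubini n r = countBy (isRFubini? n r) (allTuples (n + r))

-- Set partitions of {1,…,m} (element i+1 ↔ Fin position i), represented by
-- their equivalence relation "lies in the same block", R : Fin m → Fin m → Bool

IsEquivRel : {m : ℕ} → (Fin m → Fin m → Bool) → Set
IsEquivRel {m} R =
  ((i : Fin m) → R i i ≡ true) ×
  ((i j : Fin m) → R i j ≡ true → R j i ≡ true) ×
  ((i j k : Fin m) → R i j ≡ true → R j k ≡ true → R i k ≡ true)

isEquivRel? : {m : ℕ} (R : Fin m → Fin m → Bool) → Dec (IsEquivRel R)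
isEquivRel? R =
  all? (λ i → R i i ≟B true) ×-dec
  all? (λ i → all? (λ j → (R i j ≟B true) →-dec (R j i ≟B true))) ×-dec
  all? (λ i → all? (λ j → all? (λ k →
    (R i j ≟B true) →-dec ((R j k ≟B true) →-dec (R i k ≟B true)))))

IsBlockMin : {m : ℕ} → (Fin m → Fin m → Bool) → Fin m → Set
IsBlockMin {m} R i = (j : Fin m) → R j i ≡ true → toℕ i ≤ toℕ j

isBlockMin? : {m : ℕ} (R : Fin m → Fin m → Bool) (i : Fin m) → Dec (IsBlockMin R i)
isBlockMin? R i = all? (λ j → (R j i ≟B true) →-dec (toℕ i ≤? toℕ j))

numBlocks : {m : ℕ} → (Fin m → Fin m → Bool) → ℕ
numBlocks {m} R = countBy (isBlockMin? R) (allFin m)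

IsRPartition : (n r j : ℕ) → (Fin (n + r) → Fin (n + r) → Bool) → Set
IsRPartition n r j R =
  IsEquivRel R ×
  numBlocks R ≡ j ×
  ((a b : Fin (n + r)) → toℕ a < r → toℕ b < r → R a b ≡ true → a ≡ b)

isRPartition? : (n r j : ℕ) (R : Fin (n + r) → Fin (n + r) → Bool) →
                Dec (IsRPartition n r j R)
isRPartition? n r j R =
  isEquivRel? R ×-dec
  (numBlocks R ≟ℕ j) ×-dec
  all? (λ a → all? (λ b →
    (toℕ a <? r) →-dec ((toℕ b <? r) →-dec ((R a b ≟B true) →-dec (a ≟F b)))))

allRels : (m : ℕ) → List (Fin m → Fin m → Bool)
allRels m = allFuns m (allFuns m (false ∷ true ∷ []))

rStirling2 : (n r k : ℕ) → ℕ
rStirling2 n r k = countBy (isRPartition? n r (k + r)) (allRels (n + r))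

sumUpTo : ℕ → (ℕ → ℕ) → ℕ
sumUpTo zero    f = f 0
sumUpTo (suc n) f = sumUpTo n f + f (suc n)

Fub : (n r : ℕ) → ℕ
Fub n r = sumUpTo n (λ k → ((k + r) !) * rStirling2 n r k)

{-# OPTIONS --safe #-}
module Submission where

-- Every tuple b determines its kernel, the equivalence relation "b i = b j" on positions, and b is
-- an r-Fubini ranking exactly when it is a Fubini ranking whose kernel keeps 1, …, r in distinct
-- blocks.  So it suffices to show that an equivalence relation R with k blocks is the kernel of
-- exactly k! Fubini rankings, and then to group the relations by their number k + r of blocks.
-- A Fubini ranking is determined by the order of its values, b i = 1 + #{j | b j < b i}; hence
-- replacing every value by the number of blocks with smaller values is a bijection between the
-- Fubini rankings with kernel R and the maps with kernel R into {0, …, k-1}.  Peeling off the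
-- first position shows that there are m (m-1) ⋯ (m-k+1) maps with kernel R into an m-element set.

open import Defs
open import Data.Nat using (ℕ; zero; suc; _+_; _*_; _∸_; _≤_; _<_; z≤n; s≤s; s≤s⁻¹; _<?_; _≟_; _!; pred)
open import Data.Nat.Properties
open import Data.Nat.Induction using (<-wellFounded)
open import Data.Bool using (Bool; true; false)
open import Data.Bool.Properties using (⇔→≡; ¬-not) renaming (_≟_ to _≟B_)
open import Data.Fin using (Fin; zero; suc; toℕ; fromℕ<)
open import Data.Fin.Properties using (all?; any?; toℕ-injective) renaming (_≟_ to _≟F_; suc-injective to fsuc-injective)
open import Data.Vec.Functional using () renaming (_∷_ to _∷ᶠ_)
open import Data.List using (List; []; _∷_; map; concatMap; filter; length; _++_; upTo; allFin; tabulate)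
open import Data.List.Properties using (filter-all; filter-accept; filter-reject; length-upTo)
open import Data.List.Relation.Unary.All as All using (All; []; _∷_)
open import Data.List.Relation.Unary.All.Properties using (map⁺; concat⁺; all-filter)
open import Data.List.Relation.Unary.Any using (here; there)
open import Data.List.Membership.Propositional using (_∈_)
open import Data.List.Membership.Propositional.Properties using (∈-allFin; ∈-filter⁺; ∈-upTo⁺; ∈-upTo⁻; ∈-map⁺)
open import Data.List.Relation.Unary.Unique.Propositional using (Unique; []; _∷_)
import Data.List.Relation.Unary.Unique.Propositional.Properties as Unique
open import Data.List.Extrema.Nat using (argmin; argmax; argmin-all; argmax-all; f[argmin]≤f[xs]; f[xs]≤f[argmax])
open import Data.Unit using (⊤; tt)
open import Data.Product using (_×_; _,_; proj₁; proj₂; ∃; ∃-syntax)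
open import Data.Sum using (inj₁; inj₂)
open import Function using (_∘_; _⇔_; mk⇔; Equivalence)
open import Relation.Nullary using (Dec; yes; no; ¬_; does; contradiction)
open import Relation.Nullary.Decidable using (_×-dec_; _→-dec_; ¬?; map′; dec-true)
open import Relation.Binary.Definitions using (tri<; tri≈; tri>)
open import Relation.Binary.PropositionalEquality
open import Relation.Binary.Construct.On using () renaming (wellFounded to on-wellFounded)
import Induction.WellFounded as WF
import Algebra.Properties.CommutativeSemigroup +-commutativeSemigroup as +-CS
import Algebra.Properties.CommutativeSemigroup *-commutativeSemigroup as *-CS
open import Algebra.Properties.Semiring.Sum +-*-semiring
  using (sum-syntax; sum-cong-≗; sum-replicate-zero) renaming (∑-distrib-+ to sum-distrib-+)

𝟙 : ∀ {p} {P : Set p} → Dec P → ℕ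
𝟙 (yes _) = 1
𝟙 (no _)  = 0

module _ {p} {P : Set p} where

  𝟙-yes : (d : Dec P) → P → 𝟙 d ≡ 1
  𝟙-yes (yes _) _ = refl
  𝟙-yes (no ¬p) p = contradiction p ¬p

  𝟙-no : (d : Dec P) → ¬ P → 𝟙 d ≡ 0
  𝟙-no (yes p) ¬p = contradiction p ¬p
  𝟙-no (no _)  _  = refl

  𝟙-≤1 : (d : Dec P) → 𝟙 d ≤ 1
  𝟙-≤1 (yes _) = ≤-refl
  𝟙-≤1 (no _)  = z≤n

𝟙-mono : ∀ {p q} {P : Set p} {Q : Set q} → (P → Q) → (d : Dec P) (e : Dec Q) → 𝟙 d ≤ 𝟙 e
𝟙-mono f (yes p) e = ≤-reflexive (sym (𝟙-yes e (f p)))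
𝟙-mono f (no _)  e = z≤n

𝟙-cong : ∀ {p q} {P : Set p} {Q : Set q} → (P → Q) → (Q → P) → (d : Dec P) (e : Dec Q) → 𝟙 d ≡ 𝟙 e
𝟙-cong f g d e = ≤-antisym (𝟙-mono f d e) (𝟙-mono g e d)

𝟙-× : ∀ {p q} {P : Set p} {Q : Set q} (d : Dec P) (e : Dec Q) → 𝟙 (d ×-dec e) ≡ 𝟙 d * 𝟙 e
𝟙-× (yes _) (yes _) = refl
𝟙-× (yes _) (no _)  = refl
𝟙-× (no _)  _       = refl

𝟙-⇔-× : ∀ {p q r} {P : Set p} {Q : Set q} {S : Set r} → (P → Q × S) → (Q × S → P) →
        (d : Dec P) (e : Dec Q) (f : Dec S) → 𝟙 d ≡ 𝟙 e * 𝟙 f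
𝟙-⇔-× to from d e f = trans (𝟙-cong to from d (e ×-dec f)) (𝟙-× e f)

𝟙-all?-suc : ∀ {p} {N : ℕ} {P : Fin (suc N) → Set p} (P? : ∀ i → Dec (P i)) →
             𝟙 (all? P?) ≡ 𝟙 (P? zero) * 𝟙 (all? (P? ∘ suc))
𝟙-all?-suc P? = 𝟙-⇔-× (λ p → p zero , p ∘ suc) (λ { (p₀ , p) zero → p₀ ; (p₀ , p) (suc i) → p i })
                      (all? P?) (P? zero) (all? (P? ∘ suc))

𝟙<-split : ∀ {x y v} → y < v → (x < v → x ≤ y) → 𝟙 (x <? v) ≡ 𝟙 (x <? y) + 𝟙 (x ≟ y)
𝟙<-split {x} {y} {v} y<v x<v⇒x≤y with <-cmp x y
... | tri< x<y x≢y _   = trans (𝟙-yes (x <? v) (<-trans x<y y<v))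
                               (sym (cong₂ _+_ (𝟙-yes (x <? y) x<y) (𝟙-no (x ≟ y) x≢y)))
... | tri≈ x≮y x≡y _   = trans (𝟙-yes (x <? v) (subst (_< v) (sym x≡y) y<v))
                               (sym (cong₂ _+_ (𝟙-no (x <? y) x≮y) (𝟙-yes (x ≟ y) x≡y)))
... | tri> x≮y x≢y y<x = trans (𝟙-no (x <? v) λ x<v → <⇒≱ y<x (x<v⇒x≤y x<v))
                               (sym (cong₂ _+_ (𝟙-no (x <? y) x≮y) (𝟙-no (x ≟ y) x≢y)))

∑ : {A : Set} → List A → (A → ℕ) → ℕ
∑ []       f = 0
∑ (x ∷ xs) f = f x + ∑ xs f

syntax ∑ xs (λ x → e) = ∑[ x ∈ xs ] e

module _ {A : Set} where

  countBy≡∑𝟙 : {P : A → Set} (P? : (a : A) → Dec (P a)) (xs : List A) → countBy P? xs ≡ ∑[ x ∈ xs ] 𝟙 (P? x)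
  countBy≡∑𝟙 P? []       = refl
  countBy≡∑𝟙 P? (x ∷ xs) with P? x
  ... | yes _ = cong suc (countBy≡∑𝟙 P? xs)
  ... | no _  = countBy≡∑𝟙 P? xs

  ∑-cong : (xs : List A) {f g : A → ℕ} → f ≗ g → ∑ xs f ≡ ∑ xs g
  ∑-cong []       f≗g = refl
  ∑-cong (x ∷ xs) f≗g = cong₂ _+_ (f≗g x) (∑-cong xs f≗g)

  ∑-cong-All : {P : A → Set} {xs : List A} {f g : A → ℕ} → All P xs → (∀ {x} → P x → f x ≡ g x) →
               ∑ xs f ≡ ∑ xs g
  ∑-cong-All []       f≡g = refl
  ∑-cong-All (p ∷ ps) f≡g = cong₂ _+_ (f≡g p) (∑-cong-All ps f≡g)

  ∑-cong-∈ : (xs : List A) {f g : A → ℕ} → (∀ {x} → x ∈ xs → f x ≡ g x) → ∑ xs f ≡ ∑ xs g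
  ∑-cong-∈ xs = ∑-cong-All (All.tabulate λ x∈xs → x∈xs)

  ∑-zero : (xs : List A) → ∑[ x ∈ xs ] 0 ≡ 0
  ∑-zero []       = refl
  ∑-zero (x ∷ xs) = ∑-zero xs

  ∑-const : (xs : List A) (k : ℕ) → ∑[ x ∈ xs ] k ≡ length xs * k
  ∑-const []       k = refl
  ∑-const (x ∷ xs) k = cong (k +_) (∑-const xs k)

  ∑-distrib-+ : (xs : List A) (f g : A → ℕ) → ∑[ x ∈ xs ] (f x + g x) ≡ ∑ xs f + ∑ xs g
  ∑-distrib-+ []       f g = refl
  ∑-distrib-+ (x ∷ xs) f g =
    trans (cong (f x + g x +_) (∑-distrib-+ xs f g)) (+-CS.interchange (f x) (g x) (∑ xs f) (∑ xs g))

  ∑-*ˡ : (xs : List A) (k : ℕ) (f : A → ℕ) → ∑[ x ∈ xs ] (k * f x) ≡ k * ∑ xs f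
  ∑-*ˡ []       k f = sym (*-zeroʳ k)
  ∑-*ˡ (x ∷ xs) k f = trans (cong (k * f x +_) (∑-*ˡ xs k f)) (sym (*-distribˡ-+ k (f x) _))

  ∑-*ʳ : (xs : List A) (k : ℕ) (f : A → ℕ) → ∑[ x ∈ xs ] (f x * k) ≡ ∑ xs f * k
  ∑-*ʳ xs k f = trans (∑-cong xs λ x → *-comm (f x) k) (trans (∑-*ˡ xs k f) (*-comm k _))

  ∑-++ : (xs ys : List A) (f : A → ℕ) → ∑ (xs ++ ys) f ≡ ∑ xs f + ∑ ys f
  ∑-++ []       ys f = refl
  ∑-++ (x ∷ xs) ys f = trans (cong (f x +_) (∑-++ xs ys f)) (sym (+-assoc (f x) _ _))

  ∑-filter : {P : A → Set} (P? : (a : A) → Dec (P a)) (xs : List A) (f : A → ℕ) →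
             ∑ (filter P? xs) f ≡ ∑[ x ∈ xs ] (𝟙 (P? x) * f x)
  ∑-filter P? []       f = refl
  ∑-filter P? (x ∷ xs) f with P? x
  ... | yes _ = cong₂ _+_ (sym (+-identityʳ (f x))) (∑-filter P? xs f)
  ... | no _  = ∑-filter P? xs f

module _ {A B : Set} where

  ∑-map : (g : A → B) (xs : List A) (f : B → ℕ) → ∑ (map g xs) f ≡ ∑[ x ∈ xs ] f (g x)
  ∑-map g []       f = refl
  ∑-map g (x ∷ xs) f = cong (f (g x) +_) (∑-map g xs f)

  ∑-concatMap : (h : A → List B) (xs : List A) (f : B → ℕ) → ∑ (concatMap h xs) f ≡ ∑[ x ∈ xs ] ∑ (h x) f
  ∑-concatMap h []       f = refl
  ∑-concatMap h (x ∷ xs) f = trans (∑-++ (h x) (concatMap h xs) f) (cong (∑ (h x) f +_) (∑-concatMap h xs f))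

  ∑-comm : (xs : List A) (ys : List B) (f : A → B → ℕ) →
           ∑[ x ∈ xs ] ∑[ y ∈ ys ] f x y ≡ ∑[ y ∈ ys ] ∑[ x ∈ xs ] f x y
  ∑-comm []       ys f = sym (∑-zero ys)
  ∑-comm (x ∷ xs) ys f = trans (cong (∑ ys (f x) +_) (∑-comm xs ys f))
                               (sym (∑-distrib-+ ys (f x) λ y → ∑[ x ∈ xs ] f x y))

∑-tabulate : {A : Set} (N : ℕ) (g : Fin N → A) (f : A → ℕ) → ∑ (tabulate g) f ≡ ∑[ i < N ] f (g i)
∑-tabulate zero    g f = refl
∑-tabulate (suc N) g f = cong (f (g zero) +_) (∑-tabulate N (g ∘ suc) f)

countBy-allFin : (N : ℕ) {P : Fin N → Set} (P? : (i : Fin N) → Dec (P i)) →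
                 countBy P? (allFin N) ≡ ∑[ i < N ] 𝟙 (P? i)
countBy-allFin N P? = trans (countBy≡∑𝟙 P? (allFin N)) (∑-tabulate N (λ i → i) _)

sum-cong : (N : ℕ) {f g : Fin N → ℕ} → f ≗ g → ∑[ i < N ] f i ≡ ∑[ i < N ] g i
sum-cong N = sum-cong-≗ {N}

sum-zero : (N : ℕ) {f : Fin N → ℕ} → (∀ i → f i ≡ 0) → ∑[ i < N ] f i ≡ 0
sum-zero N f≡0 = trans (sum-cong N f≡0) (sum-replicate-zero N)

sum-ones : (N : ℕ) → ∑[ i < N ] 1 ≡ N
sum-ones zero    = refl
sum-ones (suc N) = cong suc (sum-ones N)

sum-mono : (N : ℕ) {f g : Fin N → ℕ} → (∀ i → f i ≤ g i) → ∑[ i < N ] f i ≤ ∑[ i < N ] g i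
sum-mono zero    f≤g = z≤n
sum-mono (suc N) f≤g = +-mono-≤ (f≤g zero) (sum-mono N (f≤g ∘ suc))

sum-mono-< : (N : ℕ) {f g : Fin N → ℕ} → (∀ i → f i ≤ g i) → (i : Fin N) → f i < g i →
             ∑[ i < N ] f i < ∑[ i < N ] g i
sum-mono-< (suc N) f≤g zero    fi<gi = +-mono-<-≤ fi<gi (sum-mono N (f≤g ∘ suc))
sum-mono-< (suc N) f≤g (suc i) fi<gi = +-mono-≤-< (f≤g zero) (sum-mono-< N (f≤g ∘ suc) i fi<gi)

term≤sum : (N : ℕ) (f : Fin N → ℕ) (i : Fin N) → f i ≤ ∑[ i < N ] f i
term≤sum (suc N) f zero    = m≤m+n (f zero) _
term≤sum (suc N) f (suc i) = ≤-trans (term≤sum N (f ∘ suc) i) (m≤n+m _ (f zero))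

sum-≤1⇒≤ : (N : ℕ) {f : Fin N → ℕ} → (∀ i → f i ≤ 1) → ∑[ i < N ] f i ≤ N
sum-≤1⇒≤ N f≤1 = ≤-trans (sum-mono N f≤1) (≤-reflexive (sum-ones N))

sum-≤1⇒< : (N : ℕ) {f : Fin N → ℕ} → (∀ i → f i ≤ 1) → (i : Fin N) → f i ≡ 0 → ∑[ i < N ] f i < N
sum-≤1⇒< N f≤1 i fi≡0 = ≤-trans (sum-mono-< N f≤1 i (≤-reflexive (cong suc fi≡0))) (≤-reflexive (sum-ones N))

sum-𝟙-atMostOne : (N : ℕ) {P : Fin N → Set} (P? : ∀ i → Dec (P i)) → (∀ i j → P i → P j → i ≡ j) →
                  ∑[ i < N ] 𝟙 (P? i) ≤ 1
sum-𝟙-atMostOne zero    P? unique = z≤n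
sum-𝟙-atMostOne (suc N) P? unique with P? zero
... | yes p₀ = ≤-reflexive (cong suc (sum-zero N λ i → 𝟙-no (P? (suc i)) λ p → 0≢1+n (cong toℕ (unique _ _ p₀ p))))
... | no _   = sum-𝟙-atMostOne N (P? ∘ suc) λ i j pi pj → fsuc-injective (unique _ _ pi pj)

sum-𝟙-exactlyOne : (N : ℕ) {P : Fin N → Set} (P? : ∀ i → Dec (P i)) → (∀ i j → P i → P j → i ≡ j) →
                   ∀ i → P i → ∑[ i < N ] 𝟙 (P? i) ≡ 1
sum-𝟙-exactlyOne N P? unique i pi = ≤-antisym (sum-𝟙-atMostOne N P? unique)
  (≤-trans (≤-reflexive (sym (𝟙-yes (P? i) pi))) (term≤sum N (λ i → 𝟙 (P? i)) i))

sum-𝟙-toℕ< : (N r : ℕ) → r ≤ N → ∑[ i < N ] 𝟙 (toℕ i <? r) ≡ r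
sum-𝟙-toℕ< N       zero    _         = sum-zero N λ i → 𝟙-no (toℕ i <? 0) λ ()
sum-𝟙-toℕ< (suc N) (suc r) (s≤s r≤N) = cong suc (trans
  (sum-cong N λ i → 𝟙-cong s≤s⁻¹ s≤s (suc (toℕ i) <? suc r) (toℕ i <? r))
  (sum-𝟙-toℕ< N r r≤N))

module _ {N : ℕ} {P : Fin N → Set} (P? : (i : Fin N) → Dec (P i)) (f : Fin N → ℕ) where

  private
    candidates = filter P? (allFin N)

    ∈-candidates : ∀ {l} → P l → l ∈ candidates
    ∈-candidates pl = ∈-filter⁺ P? (∈-allFin _) pl

  minimiser : ∃ P → ∃[ j ] P j × (∀ l → P l → f j ≤ f l)
  minimiser (i , pi) =
    argmin f i candidates , argmin-all f pi (all-filter P? (allFin N)) ,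
    λ l pl → All.lookup (f[argmin]≤f[xs] i candidates) (∈-candidates pl)

  maximiser : ∃ P → ∃[ j ] P j × (∀ l → P l → f l ≤ f j)
  maximiser (i , pi) =
    argmax f i candidates , argmax-all f pi (all-filter P? (allFin N)) ,
    λ l pl → All.lookup (f[xs]≤f[argmax] i candidates) (∈-candidates pl)

sumUpTo-cong : ∀ n {f g : ℕ → ℕ} → (∀ k → f k ≡ g k) → sumUpTo n f ≡ sumUpTo n g
sumUpTo-cong zero    f≡g = f≡g 0
sumUpTo-cong (suc n) f≡g = cong₂ _+_ (sumUpTo-cong n f≡g) (f≡g (suc n))

sumUpTo-zero : ∀ n {f : ℕ → ℕ} → (∀ k → k ≤ n → f k ≡ 0) → sumUpTo n f ≡ 0
sumUpTo-zero zero    f≡0 = f≡0 0 z≤n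
sumUpTo-zero (suc n) f≡0 = cong₂ _+_ (sumUpTo-zero n λ k k≤n → f≡0 k (m≤n⇒m≤1+n k≤n)) (f≡0 (suc n) ≤-refl)

sumUpTo-select : ∀ n {d} → d ≤ n → (f : ℕ → ℕ) → sumUpTo n (λ k → f k * 𝟙 (k ≟ d)) ≡ f d
sumUpTo-select n {d} d≤n f = go n d≤n
  where
  off : ∀ k → k ≢ d → f k * 𝟙 (k ≟ d) ≡ 0
  off k k≢d = trans (cong (f k *_) (𝟙-no (k ≟ d) k≢d)) (*-zeroʳ (f k))
  on : f d * 𝟙 (d ≟ d) ≡ f d
  on = trans (cong (f d *_) (𝟙-yes (d ≟ d) refl)) (*-identityʳ (f d))
  go : ∀ m → d ≤ m → sumUpTo m (λ k → f k * 𝟙 (k ≟ d)) ≡ f d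
  go zero    z≤n = on
  go (suc m) d≤1+m with m≤n⇒m<n∨m≡n d≤1+m
  ... | inj₁ (s≤s d≤m) = trans (cong₂ _+_ (go m d≤m) (off (suc m) λ 1+m≡d → <-irrefl (sym 1+m≡d) (s≤s d≤m)))
                               (+-identityʳ (f d))
  ... | inj₂ refl      = cong₂ _+_ (sumUpTo-zero m λ k k≤m → off k λ k≡d → <-irrefl k≡d (s≤s k≤m)) on

sumUpTo-∑-comm : ∀ {A : Set} n (xs : List A) (f : ℕ → A → ℕ) →
                 sumUpTo n (λ k → ∑[ x ∈ xs ] f k x) ≡ ∑[ x ∈ xs ] sumUpTo n (λ k → f k x)
sumUpTo-∑-comm zero    xs f = refl
sumUpTo-∑-comm (suc n) xs f = trans (cong (_+ ∑[ x ∈ xs ] f (suc n) x) (sumUpTo-∑-comm n xs f))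
                                    (sym (∑-distrib-+ xs (λ x → sumUpTo n (λ k → f k x)) (f (suc n))))

module _ {A : Set} where

  ≗-Invariant : {N : ℕ} → ((Fin N → A) → ℕ) → Set
  ≗-Invariant F = ∀ {f g} → f ≗ g → F f ≡ F g

  ∑-allFuns-zero : (xs : List A) (F : (Fin 0 → A) → ℕ) {c : ℕ} → (∀ f → F f ≡ c) → ∑ (allFuns 0 xs) F ≡ c
  ∑-allFuns-zero xs F F≡c = trans (+-identityʳ _) (F≡c _)

  ∑-allFuns-suc : (N : ℕ) (xs : List A) (F : (Fin (suc N) → A) → ℕ) → ≗-Invariant F →
                  ∑ (allFuns (suc N) xs) F ≡ ∑[ a ∈ xs ] ∑[ f ∈ allFuns N xs ] F (a ∷ᶠ f)
  ∑-allFuns-suc N xs F F-inv = trans (∑-concatMap _ xs F) (∑-cong xs λ a →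
    trans (∑-map _ (allFuns N xs) F) (∑-cong (allFuns N xs) λ f → F-inv λ { zero → refl ; (suc i) → refl }))

  allFuns-∈ : (N : ℕ) (xs : List A) → All (λ f → ∀ i → f i ∈ xs) (allFuns N xs)
  allFuns-∈ zero    xs = (λ ()) ∷ []
  allFuns-∈ (suc N) xs = concat⁺ (map⁺ (All.tabulate λ {a} a∈xs →
    map⁺ (All.map (λ f⊆xs → λ { zero → a∈xs ; (suc i) → f⊆xs i }) (allFuns-∈ N xs))))

  ∑-allFuns-match : {E : A → A → Set} (E? : ∀ a b → Dec (E a b)) (N : ℕ) (xs : List A) (g : Fin N → A) →
                    (∀ i → ∑[ a ∈ xs ] 𝟙 (E? a (g i)) ≡ 1) →
                    ∑[ f ∈ allFuns N xs ] 𝟙 (all? λ i → E? (f i) (g i)) ≡ 1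
  ∑-allFuns-match E? zero    xs g one-match = ∑-allFuns-zero xs _ λ f → 𝟙-yes (all? λ i → E? (f i) (g i)) λ ()
  ∑-allFuns-match {E} E? (suc N) xs g one-match = begin
    ∑[ f ∈ allFuns (suc N) xs ] 𝟙 (all? λ i → E? (f i) (g i))
      ≡⟨ ∑-allFuns-suc N xs _ (λ f≗f′ → 𝟙-cong (λ e i → subst (λ x → E x _) (f≗f′ i) (e i))
                                                (λ e i → subst (λ x → E x _) (sym (f≗f′ i)) (e i)) _ _) ⟩
    ∑[ a ∈ xs ] ∑[ f ∈ allFuns N xs ] 𝟙 (all? λ i → E? ((a ∷ᶠ f) i) (g i))
      ≡⟨ ∑-cong xs (λ a → ∑-cong (allFuns N xs) λ f → 𝟙-all?-suc λ i → E? ((a ∷ᶠ f) i) (g i)) ⟩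
    ∑[ a ∈ xs ] ∑[ f ∈ allFuns N xs ] (𝟙 (E? a (g zero)) * 𝟙 (all? λ i → E? (f i) (g (suc i))))
      ≡⟨ ∑-cong xs (λ a → ∑-*ˡ (allFuns N xs) (𝟙 (E? a (g zero))) λ f → 𝟙 (all? λ i → E? (f i) (g (suc i)))) ⟩
    ∑[ a ∈ xs ] (𝟙 (E? a (g zero)) * ∑[ f ∈ allFuns N xs ] 𝟙 (all? λ i → E? (f i) (g (suc i))))
      ≡⟨ ∑-cong xs (λ a → cong (𝟙 (E? a (g zero)) *_) (∑-allFuns-match E? N xs (g ∘ suc) (one-match ∘ suc))) ⟩
    ∑[ a ∈ xs ] (𝟙 (E? a (g zero)) * 1)
      ≡⟨ trans (∑-cong xs λ a → *-identityʳ _) (one-match zero) ⟩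
    1 ∎
    where open ≡-Reasoning

  ∑-allFuns-filter : (N : ℕ) (xs : List A) {Q : A → Set} (Q? : ∀ a → Dec (Q a)) (F : (Fin N → A) → ℕ) →
                     ≗-Invariant F →
                     ∑[ f ∈ allFuns N xs ] (F f * 𝟙 (all? λ i → Q? (f i))) ≡ ∑ (allFuns N (filter Q? xs)) F
  ∑-allFuns-filter zero xs Q? F F-inv = cong (_+ 0) (no-condition _)
    where
    no-condition : (f : Fin 0 → A) → F f * 𝟙 (all? λ i → Q? (f i)) ≡ F f
    no-condition f = trans (cong (F f *_) (𝟙-yes (all? λ i → Q? (f i)) λ ())) (*-identityʳ _)
  ∑-allFuns-filter (suc N) xs {Q} Q? F F-inv = begin
    ∑[ f ∈ allFuns (suc N) xs ] (F f * 𝟙 (all? λ i → Q? (f i)))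
      ≡⟨ ∑-allFuns-suc N xs _ (λ f≗f′ → cong₂ _*_ (F-inv f≗f′)
           (𝟙-cong (λ q i → subst Q (f≗f′ i) (q i)) (λ q i → subst Q (sym (f≗f′ i)) (q i)) _ _)) ⟩
    ∑[ a ∈ xs ] ∑[ f ∈ allFuns N xs ] (F (a ∷ᶠ f) * 𝟙 (all? λ i → Q? ((a ∷ᶠ f) i)))
      ≡⟨ ∑-cong xs (λ a → ∑-cong (allFuns N xs) λ f → split a f) ⟩
    ∑[ a ∈ xs ] ∑[ f ∈ allFuns N xs ] (𝟙 (Q? a) * (F (a ∷ᶠ f) * 𝟙 (all? λ i → Q? (f i))))
      ≡⟨ ∑-cong xs (λ a → ∑-*ˡ (allFuns N xs) (𝟙 (Q? a)) λ f → F (a ∷ᶠ f) * 𝟙 (all? λ i → Q? (f i))) ⟩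
    ∑[ a ∈ xs ] (𝟙 (Q? a) * ∑[ f ∈ allFuns N xs ] (F (a ∷ᶠ f) * 𝟙 (all? λ i → Q? (f i))))
      ≡⟨ ∑-cong xs (λ a → cong (𝟙 (Q? a) *_) (∑-allFuns-filter N xs Q? (F ∘ (a ∷ᶠ_))
           λ f≗f′ → F-inv λ { zero → refl ; (suc i) → f≗f′ i })) ⟩
    ∑[ a ∈ xs ] (𝟙 (Q? a) * ∑[ f ∈ allFuns N (filter Q? xs) ] F (a ∷ᶠ f))
      ≡⟨ ∑-filter Q? xs _ ⟨
    ∑[ a ∈ filter Q? xs ] ∑[ f ∈ allFuns N (filter Q? xs) ] F (a ∷ᶠ f)
      ≡⟨ ∑-allFuns-suc N (filter Q? xs) F F-inv ⟨
    ∑ (allFuns (suc N) (filter Q? xs)) F ∎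
    where
    open ≡-Reasoning
    split : ∀ a f → F (a ∷ᶠ f) * 𝟙 (all? λ i → Q? ((a ∷ᶠ f) i))
                  ≡ 𝟙 (Q? a) * (F (a ∷ᶠ f) * 𝟙 (all? λ i → Q? (f i)))
    split a f = trans (cong (F (a ∷ᶠ f) *_) (𝟙-all?-suc λ i → Q? ((a ∷ᶠ f) i)))
                      (*-CS.x∙yz≈y∙xz (F (a ∷ᶠ f)) (𝟙 (Q? a)) _)

module _ {v : ℕ} where

  ∑-𝟙≟-unique : {xs : List ℕ} → Unique xs → v ∈ xs → ∑[ a ∈ xs ] 𝟙 (a ≟ v) ≡ 1
  ∑-𝟙≟-unique {_ ∷ ys} (v∉ys ∷ _) (here refl) =
    cong₂ _+_ (𝟙-yes (v ≟ v) refl) (trans (∑-cong-All v∉ys λ v≢a → 𝟙-no (_ ≟ v) (v≢a ∘ sym)) (∑-zero ys))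
  ∑-𝟙≟-unique (x∉ys ∷ ys!) (there v∈ys) =
    cong₂ _+_ (𝟙-no (_ ≟ v) (All.lookup x∉ys v∈ys)) (∑-𝟙≟-unique ys! v∈ys)

  length-filter-≢ : {xs : List ℕ} → Unique xs → v ∈ xs → length (filter (λ a → ¬? (a ≟ v)) xs) ≡ pred (length xs)
  length-filter-≢ (v∉ys ∷ _) (here refl) = trans
    (cong length (filter-reject (λ a → ¬? (a ≟ v)) λ v≢v → v≢v refl))
    (cong length (filter-all (λ a → ¬? (a ≟ v)) (All.map (λ v≢a → v≢a ∘ sym) v∉ys)))
  length-filter-≢ {x ∷ y ∷ ys} (x∉ys ∷ ys!) (there v∈ys) = trans
    (cong length (filter-accept (λ a → ¬? (a ≟ v)) (All.lookup x∉ys v∈ys)))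
    (cong suc (length-filter-≢ ys! v∈ys))

_≗?_ : {N : ℕ} (f g : Fin N → ℕ) → Dec (f ≗ g)
f ≗? g = all? λ i → f i ≟ g i

∑-allFuns-unique-match : {N : ℕ} {xs : List ℕ} → Unique xs → (g : Fin N → ℕ) → (∀ i → g i ∈ xs) →
                         ∑[ f ∈ allFuns N xs ] 𝟙 (f ≗? g) ≡ 1
∑-allFuns-unique-match {N} {xs} xs! g g∈xs = ∑-allFuns-match _≟_ N xs g λ i → ∑-𝟙≟-unique xs! (g∈xs i)

-- Without function extensionality, functions are identified up to ≗, which is how allFuns lists them.
record ≗-Bijection {N : ℕ} (P Q : (Fin N → ℕ) → Set) (xs ys : List ℕ) : Set where
  field
    to        : (Fin N → ℕ) → Fin N → ℕ
    from      : (Fin N → ℕ) → Fin N → ℕ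
    to-cong   : ∀ {a a′} → a ≗ a′ → to a ≗ to a′
    from-cong : ∀ {b b′} → b ≗ b′ → from b ≗ from b′
    P-resp    : ∀ {a a′} → a ≗ a′ → P a → P a′
    Q-resp    : ∀ {b b′} → b ≗ b′ → Q b → Q b′
    to-Q      : ∀ {a} → P a → Q (to a)
    from-P    : ∀ {b} → Q b → P (from b)
    to-∈      : ∀ {a} → P a → ∀ i → to a i ∈ ys
    from-∈    : ∀ {b} → Q b → ∀ i → from b i ∈ xs
    from-to   : ∀ {a} → P a → from (to a) ≗ a
    to-from   : ∀ {b} → Q b → to (from b) ≗ b

module _ {N : ℕ} {P Q : (Fin N → ℕ) → Set} {xs ys : List ℕ} where

  -- Both sides count the pairs (a , b) with P a and b ≗ to a, equivalently with Q b and a ≗ from b.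
  ∑-allFuns-≗-Bijection : Unique xs → Unique ys → ≗-Bijection P Q xs ys →
                          (P? : ∀ a → Dec (P a)) (Q? : ∀ b → Dec (Q b)) →
                          ∑[ a ∈ allFuns N xs ] 𝟙 (P? a) ≡ ∑[ b ∈ allFuns N ys ] 𝟙 (Q? b)
  ∑-allFuns-≗-Bijection xs! ys! B P? Q? = begin
    ∑[ a ∈ As ] 𝟙 (P? a)
      ≡⟨ ∑-cong As (λ a → matched (P? a) ys! (to a) to-∈) ⟩
    ∑[ a ∈ As ] ∑[ b ∈ Bs ] 𝟙 (P? a ×-dec b ≗? to a)
      ≡⟨ ∑-cong As (λ a → ∑-cong Bs λ b → 𝟙-cong (swap a b) (unswap a b) _ _) ⟩
    ∑[ a ∈ As ] ∑[ b ∈ Bs ] 𝟙 (Q? b ×-dec a ≗? from b)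
      ≡⟨ ∑-comm As Bs _ ⟩
    ∑[ b ∈ Bs ] ∑[ a ∈ As ] 𝟙 (Q? b ×-dec a ≗? from b)
      ≡⟨ ∑-cong Bs (λ b → matched (Q? b) xs! (from b) from-∈) ⟨
    ∑[ b ∈ Bs ] 𝟙 (Q? b) ∎
    where
    open ≡-Reasoning
    open ≗-Bijection B
    As = allFuns N xs
    Bs = allFuns N ys
    swap : ∀ a b → P a × b ≗ to a → Q b × a ≗ from b
    swap a b (pa , b≗) = Q-resp (sym ∘ b≗) (to-Q pa) , λ i → trans (sym (from-to pa i)) (from-cong (sym ∘ b≗) i)
    unswap : ∀ a b → Q b × a ≗ from b → P a × b ≗ to a
    unswap a b (qb , a≗) = P-resp (sym ∘ a≗) (from-P qb) , λ i → trans (sym (to-from qb i)) (to-cong (sym ∘ a≗) i)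
    matched : ∀ {R : Set} (d : Dec R) {zs : List ℕ} → Unique zs → (g : Fin N → ℕ) → (R → ∀ i → g i ∈ zs) →
              𝟙 d ≡ ∑[ c ∈ allFuns N zs ] 𝟙 (d ×-dec c ≗? g)
    matched (yes r) {zs} zs! g g∈zs = sym (trans (∑-cong (allFuns N zs) λ c → trans (𝟙-× (yes r) (c ≗? g)) (+-identityʳ _))
                                                 (∑-allFuns-unique-match zs! g (g∈zs r)))
    matched (no _)  {zs} _   _ _    = sym (∑-zero (allFuns N zs))

Rel : ℕ → Set
Rel N = Fin N → Fin N → Bool

kernel : {N : ℕ} → (Fin N → ℕ) → Rel N
kernel c i j = does (c i ≟ c j)

record HasKernel {N : ℕ} (c : Fin N → ℕ) (R : Rel N) : Set where
  constructor mkHasKernel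
  field ≡kernel : ∀ i j → R i j ≡ kernel c i j
open HasKernel public

HasKernel? : {N : ℕ} (c : Fin N → ℕ) (R : Rel N) → Dec (HasKernel c R)
HasKernel? c R = map′ mkHasKernel ≡kernel (all? λ i → all? λ j → R i j ≟B kernel c i j)

does⇒witness : ∀ {p} {P : Set p} (d : Dec P) → does d ≡ true → P
does⇒witness (yes p) _ = p

module _ {N : ℕ} {c : Fin N → ℕ} {R : Rel N} where

  related⇒≡ : HasKernel c R → ∀ {i j} → R i j ≡ true → c i ≡ c j
  related⇒≡ K {i} {j} Rij = does⇒witness (c i ≟ c j) (trans (sym (≡kernel K i j)) Rij)

  ≡⇒related : HasKernel c R → ∀ {i j} → c i ≡ c j → R i j ≡ true
  ≡⇒related K {i} {j} ci≡cj = trans (≡kernel K i j) (dec-true (c i ≟ c j) ci≡cj)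

  hasKernel : (∀ {i j} → R i j ≡ true → c i ≡ c j) → (∀ {i j} → c i ≡ c j → R i j ≡ true) → HasKernel c R
  hasKernel ⇒≡ ≡⇒ = mkHasKernel λ i j →
    ⇔→≡ (mk⇔ (dec-true (c i ≟ c j) ∘ ⇒≡) (≡⇒ ∘ does⇒witness (c i ≟ c j)))

  kernel-isEquivRel : HasKernel c R → IsEquivRel R
  kernel-isEquivRel K = (λ i → ≡⇒related K refl) ,
                        (λ i j Rij → ≡⇒related K (sym (related⇒≡ K Rij))) ,
                        (λ i j k Rij Rjk → ≡⇒related K (trans (related⇒≡ K Rij) (related⇒≡ K Rjk)))

HasKernel-resp-≗ : {N : ℕ} {c c′ : Fin N → ℕ} {R : Rel N} → c ≗ c′ → HasKernel c R → HasKernel c′ R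
HasKernel-resp-≗ c≗c′ K = hasKernel (λ Rij → trans (sym (c≗c′ _)) (trans (related⇒≡ K Rij) (c≗c′ _)))
                                    (λ eq → ≡⇒related K (trans (c≗c′ _) (trans eq (sym (c≗c′ _)))))

HasKernel-≗-Invariant : {N : ℕ} (R : Rel N) → ≗-Invariant (λ c → 𝟙 (HasKernel? c R))
HasKernel-≗-Invariant R c≗c′ = 𝟙-cong (HasKernel-resp-≗ c≗c′) (HasKernel-resp-≗ (sym ∘ c≗c′)) _ _

∑-allRels-HasKernel : {N : ℕ} (c : Fin N → ℕ) → ∑[ R ∈ allRels N ] 𝟙 (HasKernel? c R) ≡ 1
∑-allRels-HasKernel {N} c = trans
  (∑-cong (allRels N) λ R → 𝟙-cong ≡kernel mkHasKernel (HasKernel? c R) _)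
  (∑-allFuns-match (λ row row′ → all? λ j → row j ≟B row′ j) N _ (kernel c) λ i →
    ∑-allFuns-match _≟B_ N _ (kernel c i) λ j → one-match (kernel c i j))
  where
  one-match : (x : Bool) → ∑[ a ∈ false ∷ true ∷ [] ] 𝟙 (a ≟B x) ≡ 1
  one-match false = refl
  one-match true  = refl

module _ {N : ℕ} {R : Rel N} (E : IsEquivRel R) where

  R-refl : ∀ i → R i i ≡ true
  R-refl = proj₁ E

  R-sym : ∀ {i j} → R i j ≡ true → R j i ≡ true
  R-sym = proj₁ (proj₂ E) _ _

  R-trans : ∀ {i j k} → R i j ≡ true → R j k ≡ true → R i k ≡ true
  R-trans = proj₂ (proj₂ E) _ _ _

  blockMin-exists : ∀ i → ∃[ m ] IsBlockMin R m × R m i ≡ true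
  blockMin-exists i with m , Rmi , least ← minimiser (λ l → R l i ≟B true) toℕ (i , R-refl i) =
    m , (λ l Rlm → least l (R-trans Rlm Rmi)) , Rmi

  blockMin-unique : ∀ {m m′} → IsBlockMin R m → IsBlockMin R m′ → R m m′ ≡ true → m ≡ m′
  blockMin-unique m-min m′-min Rmm′ = toℕ-injective (≤-antisym (m-min _ (R-sym Rmm′)) (m′-min _ Rmm′))

numBlocks≡∑ : {N : ℕ} (R : Rel N) → numBlocks R ≡ ∑[ i < N ] 𝟙 (isBlockMin? R i)
numBlocks≡∑ {N} R = countBy-allFin N (isBlockMin? R)

numBlocks-≤ : {N : ℕ} (R : Rel N) → numBlocks R ≤ N
numBlocks-≤ {N} R = ≤-trans (≤-reflexive (numBlocks≡∑ R)) (sum-≤1⇒≤ N (𝟙-≤1 ∘ isBlockMin? R))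

tailRel : {N : ℕ} → Rel (suc N) → Rel N
tailRel R i j = R (suc i) (suc j)

tailRel-isEquivRel : {N : ℕ} {R : Rel (suc N)} → IsEquivRel R → IsEquivRel (tailRel R)
tailRel-isEquivRel (refl′ , sym′ , trans′) =
  (refl′ ∘ suc) , (λ i j → sym′ (suc i) (suc j)) , (λ i j k → trans′ (suc i) (suc j) (suc k))

module _ {N : ℕ} (R : Rel (suc N)) where

  private
    R′ = tailRel R

  numBlocks-suc : numBlocks R ≡ suc (∑[ j < N ] (𝟙 (R zero (suc j) ≟B false) * 𝟙 (isBlockMin? R′ j)))
  numBlocks-suc = trans (numBlocks≡∑ R) (cong₂ _+_
    (𝟙-yes (isBlockMin? R zero) λ _ _ → z≤n)
    (sum-cong N λ j → 𝟙-⇔-× to from (isBlockMin? R (suc j)) (R zero (suc j) ≟B false) (isBlockMin? R′ j)))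
    where
    to : ∀ {j} → IsBlockMin R (suc j) → R zero (suc j) ≡ false × IsBlockMin R′ j
    to {j} j-min with R zero (suc j) in R0j
    ... | true  = contradiction (j-min zero R0j) λ ()
    ... | false = refl , λ l Rlj → s≤s⁻¹ (j-min (suc l) Rlj)
    from : ∀ {j} → R zero (suc j) ≡ false × IsBlockMin R′ j → IsBlockMin R (suc j)
    from (R0j , j-min) zero    Rj0 = contradiction (trans (sym R0j) Rj0) λ ()
    from (R0j , j-min) (suc l) Rlj = s≤s (j-min l Rlj)

  numBlocks-separate : (∀ j → R zero (suc j) ≡ false) → numBlocks R ≡ suc (numBlocks R′)
  numBlocks-separate R0j≡false = trans numBlocks-suc (cong suc (trans
    (sum-cong N λ j → trans (cong (_* 𝟙 (isBlockMin? R′ j)) (𝟙-yes (R zero (suc j) ≟B false) (R0j≡false j)))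
                            (+-identityʳ _))
    (sym (numBlocks≡∑ R′))))

  numBlocks-joined : IsEquivRel R → ∀ {j₀} → R zero (suc j₀) ≡ true → numBlocks R ≡ numBlocks R′
  numBlocks-joined E {j₀} R0j₀ = begin
    numBlocks R
      ≡⟨ numBlocks-suc ⟩
    suc (∑[ j < N ] (separate j * min j))
      ≡⟨ +-comm 1 _ ⟩
    ∑[ j < N ] (separate j * min j) + 1
      ≡⟨ cong (∑[ j < N ] (separate j * min j) +_) one-min ⟨
    ∑[ j < N ] (separate j * min j) + ∑[ j < N ] (joined j * min j)
      ≡⟨ sum-distrib-+ (λ j → separate j * min j) (λ j → joined j * min j) ⟨
    ∑[ j < N ] (separate j * min j + joined j * min j)
      ≡⟨ sum-cong N (λ j → trans (sym (*-distribʳ-+ (min j) (separate j) (joined j)))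
                                 (trans (cong (_* min j) (either (R zero (suc j)))) (+-identityʳ _))) ⟩
    ∑[ j < N ] min j
      ≡⟨ numBlocks≡∑ R′ ⟨
    numBlocks R′ ∎
    where
    open ≡-Reasoning
    E′ = tailRel-isEquivRel E
    separate joined min : Fin N → ℕ
    separate j = 𝟙 (R zero (suc j) ≟B false)
    joined   j = 𝟙 (R zero (suc j) ≟B true)
    min      j = 𝟙 (isBlockMin? R′ j)
    either : (x : Bool) → 𝟙 (x ≟B false) + 𝟙 (x ≟B true) ≡ 1
    either false = refl
    either true  = refl
    one-min : ∑[ j < N ] (joined j * min j) ≡ 1
    one-min with m , m-min , Rmj₀ ← blockMin-exists E′ j₀ = trans
      (sum-cong N λ j → sym (𝟙-⇔-× (λ (R′j₀j , j-min) → R-trans E R0j₀ R′j₀j , j-min)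
                                   (λ (R0j , j-min) → R-trans E (R-sym E R0j₀) R0j , j-min)
                                   ((R′ j₀ j ≟B true) ×-dec isBlockMin? R′ j) (R zero (suc j) ≟B true) (isBlockMin? R′ j)))
      (sum-𝟙-exactlyOne N (λ j → (R′ j₀ j ≟B true) ×-dec isBlockMin? R′ j)
        (λ i j (R′j₀i , i-min) (R′j₀j , j-min) →
          blockMin-unique E′ i-min j-min (R-trans E′ (R-sym E′ R′j₀i) R′j₀j))
        m (R-sym E′ Rmj₀ , m-min))

module _ {N : ℕ} {R : Rel (suc N)} (E : IsEquivRel R) (a : ℕ) (c : Fin N → ℕ) where

  private
    R′ = tailRel R

  HasKernel-∷-separate : (∀ j → R zero (suc j) ≡ false) →
                         HasKernel (a ∷ᶠ c) R ⇔ (HasKernel c R′ × (∀ j → ¬ c j ≡ a))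
  HasKernel-∷-separate R0j≡false = mk⇔
    (λ K → mkHasKernel (λ i j → ≡kernel K (suc i) (suc j)) ,
           λ j cj≡a → contradiction (trans (sym (R0j≡false j)) (≡⇒related K (sym cj≡a))) λ ())
    (λ (K′ , c≢a) → hasKernel (⇒≡ K′) (≡⇒ K′ c≢a))
    where
    ⇒≡ : HasKernel c R′ → ∀ {i j} → R i j ≡ true → (a ∷ᶠ c) i ≡ (a ∷ᶠ c) j
    ⇒≡ K′ {zero}  {zero}  _   = refl
    ⇒≡ K′ {zero}  {suc j} R0j = contradiction (trans (sym (R0j≡false j)) R0j) λ ()
    ⇒≡ K′ {suc i} {zero}  Ri0 = contradiction (trans (sym (R0j≡false i)) (R-sym E Ri0)) λ ()
    ⇒≡ K′ {suc i} {suc j} Rij = related⇒≡ K′ Rij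
    ≡⇒ : HasKernel c R′ → (∀ j → ¬ c j ≡ a) → ∀ {i j} → (a ∷ᶠ c) i ≡ (a ∷ᶠ c) j → R i j ≡ true
    ≡⇒ K′ c≢a {zero}  {zero}  _  = R-refl E zero
    ≡⇒ K′ c≢a {zero}  {suc j} eq = contradiction (sym eq) (c≢a j)
    ≡⇒ K′ c≢a {suc i} {zero}  eq = contradiction eq (c≢a i)
    ≡⇒ K′ c≢a {suc i} {suc j} eq = ≡⇒related K′ eq

  HasKernel-∷-joined : ∀ {j₀} → R zero (suc j₀) ≡ true → HasKernel (a ∷ᶠ c) R ⇔ (a ≡ c j₀ × HasKernel c R′)
  HasKernel-∷-joined {j₀} R0j₀ = mk⇔
    (λ K → related⇒≡ K R0j₀ , mkHasKernel (λ i j → ≡kernel K (suc i) (suc j)))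
    (λ (a≡cj₀ , K′) → hasKernel (⇒≡ K′ a≡cj₀) (≡⇒ K′ a≡cj₀))
    where
    ⇒≡ : HasKernel c R′ → a ≡ c j₀ → ∀ {i j} → R i j ≡ true → (a ∷ᶠ c) i ≡ (a ∷ᶠ c) j
    ⇒≡ K′ a≡cj₀ {zero}  {zero}  _   = refl
    ⇒≡ K′ a≡cj₀ {zero}  {suc j} R0j = trans a≡cj₀ (related⇒≡ K′ (R-trans E (R-sym E R0j₀) R0j))
    ⇒≡ K′ a≡cj₀ {suc i} {zero}  Ri0 = trans (related⇒≡ K′ (R-trans E Ri0 R0j₀)) (sym a≡cj₀)
    ⇒≡ K′ a≡cj₀ {suc i} {suc j} Rij = related⇒≡ K′ Rij
    ≡⇒ : HasKernel c R′ → a ≡ c j₀ → ∀ {i j} → (a ∷ᶠ c) i ≡ (a ∷ᶠ c) j → R i j ≡ true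
    ≡⇒ K′ a≡cj₀ {zero}  {zero}  _  = R-refl E zero
    ≡⇒ K′ a≡cj₀ {zero}  {suc j} eq = R-trans E R0j₀ (≡⇒related K′ (trans (sym a≡cj₀) eq))
    ≡⇒ K′ a≡cj₀ {suc i} {zero}  eq = R-trans E (≡⇒related K′ (trans eq a≡cj₀)) (R-sym E R0j₀)
    ≡⇒ K′ a≡cj₀ {suc i} {suc j} eq = ≡⇒related K′ eq

fallingFactorial : ℕ → ℕ → ℕ
fallingFactorial m zero    = 1
fallingFactorial m (suc k) = m * fallingFactorial (pred m) k

fallingFactorial-n-n : ∀ n → fallingFactorial n n ≡ n !
fallingFactorial-n-n zero    = refl
fallingFactorial-n-n (suc n) = cong (suc n *_) (fallingFactorial-n-n n)

KernelCount : ℕ → Set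
KernelCount N = ∀ {R : Rel N} → IsEquivRel R → ∀ {xs} → Unique xs →
                ∑[ c ∈ allFuns N xs ] 𝟙 (HasKernel? c R) ≡ fallingFactorial (length xs) (numBlocks R)

module _ {N : ℕ} (count : KernelCount N) {R : Rel (suc N)} (E : IsEquivRel R) {xs : List ℕ} (xs! : Unique xs) where

  private
    R′ = tailRel R
    E′ = tailRel-isEquivRel E

  kernelCount-separate : (∀ j → R zero (suc j) ≡ false) →
    ∑[ c ∈ allFuns (suc N) xs ] 𝟙 (HasKernel? c R) ≡ fallingFactorial (length xs) (numBlocks R)
  kernelCount-separate R0j≡false = begin
    ∑[ c ∈ allFuns (suc N) xs ] 𝟙 (HasKernel? c R)
      ≡⟨ ∑-allFuns-suc N xs _ (HasKernel-≗-Invariant R) ⟩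
    ∑[ a ∈ xs ] ∑[ c ∈ allFuns N xs ] 𝟙 (HasKernel? (a ∷ᶠ c) R)
      ≡⟨ ∑-cong xs (λ a → ∑-cong (allFuns N xs) λ c → let open Equivalence (HasKernel-∷-separate E a c R0j≡false) in
           𝟙-⇔-× to from (HasKernel? (a ∷ᶠ c) R) (HasKernel? c R′) (all? λ j → ¬? (c j ≟ a))) ⟩
    ∑[ a ∈ xs ] ∑[ c ∈ allFuns N xs ] (𝟙 (HasKernel? c R′) * 𝟙 (all? λ j → ¬? (c j ≟ a)))
      ≡⟨ ∑-cong xs (λ a → ∑-allFuns-filter N xs (λ v → ¬? (v ≟ a)) _ (HasKernel-≗-Invariant R′)) ⟩
    ∑[ a ∈ xs ] ∑[ c ∈ allFuns N (filter (λ v → ¬? (v ≟ a)) xs) ] 𝟙 (HasKernel? c R′)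
      ≡⟨ ∑-cong-∈ xs (λ a∈xs → trans (count E′ (Unique.filter⁺ _ xs!))
                                     (cong (λ m → fallingFactorial m (numBlocks R′)) (length-filter-≢ xs! a∈xs))) ⟩
    ∑[ a ∈ xs ] fallingFactorial (pred (length xs)) (numBlocks R′)
      ≡⟨ ∑-const xs _ ⟩
    fallingFactorial (length xs) (suc (numBlocks R′))
      ≡⟨ cong (fallingFactorial (length xs)) (numBlocks-separate R R0j≡false) ⟨
    fallingFactorial (length xs) (numBlocks R) ∎
    where open ≡-Reasoning

  kernelCount-joined : ∀ {j₀} → R zero (suc j₀) ≡ true →
    ∑[ c ∈ allFuns (suc N) xs ] 𝟙 (HasKernel? c R) ≡ fallingFactorial (length xs) (numBlocks R)
  kernelCount-joined {j₀} R0j₀ = begin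
    ∑[ c ∈ allFuns (suc N) xs ] 𝟙 (HasKernel? c R)
      ≡⟨ ∑-allFuns-suc N xs _ (HasKernel-≗-Invariant R) ⟩
    ∑[ a ∈ xs ] ∑[ c ∈ allFuns N xs ] 𝟙 (HasKernel? (a ∷ᶠ c) R)
      ≡⟨ ∑-cong xs (λ a → ∑-cong (allFuns N xs) λ c → let open Equivalence (HasKernel-∷-joined E a c R0j₀) in
           𝟙-⇔-× to from (HasKernel? (a ∷ᶠ c) R) (a ≟ c j₀) (HasKernel? c R′)) ⟩
    ∑[ a ∈ xs ] ∑[ c ∈ allFuns N xs ] (𝟙 (a ≟ c j₀) * 𝟙 (HasKernel? c R′))
      ≡⟨ ∑-comm xs (allFuns N xs) _ ⟩
    ∑[ c ∈ allFuns N xs ] ∑[ a ∈ xs ] (𝟙 (a ≟ c j₀) * 𝟙 (HasKernel? c R′))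
      ≡⟨ ∑-cong-All (allFuns-∈ N xs) (λ {c} c∈xs → trans (∑-*ʳ xs (𝟙 (HasKernel? c R′)) λ a → 𝟙 (a ≟ c j₀))
           (trans (cong (_* 𝟙 (HasKernel? c R′)) (∑-𝟙≟-unique xs! (c∈xs j₀))) (+-identityʳ _))) ⟩
    ∑[ c ∈ allFuns N xs ] 𝟙 (HasKernel? c R′)
      ≡⟨ count E′ xs! ⟩
    fallingFactorial (length xs) (numBlocks R′)
      ≡⟨ cong (fallingFactorial (length xs)) (numBlocks-joined R E R0j₀) ⟨
    fallingFactorial (length xs) (numBlocks R) ∎
    where open ≡-Reasoning

kernelCount : (N : ℕ) → KernelCount N
kernelCount zero    {R} E {xs} _ = ∑-allFuns-zero xs _ λ c → 𝟙-yes (HasKernel? c R) (mkHasKernel λ ())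
kernelCount (suc N) {R} E xs! with any? (λ j → R zero (suc j) ≟B true)
... | yes (j₀ , R0j₀) = kernelCount-joined (kernelCount N) E xs! R0j₀
... | no none         = kernelCount-separate (kernelCount N) E xs! λ j → ¬-not λ R0j → none (j , R0j)

module _ {N : ℕ} where

  countBelow : (Fin N → ℕ) → ℕ → ℕ
  countBelow c v = ∑[ j < N ] 𝟙 (c j <? v)

  countBelow-mono : (c : Fin N → ℕ) → ∀ {v w} → v ≤ w → countBelow c v ≤ countBelow c w
  countBelow-mono c v≤w = sum-mono N λ j → 𝟙-mono (λ cj<v → <-≤-trans cj<v v≤w) _ _

  countBelow-cong : ∀ {c c′ : Fin N → ℕ} → c ≗ c′ → ∀ v → countBelow c v ≡ countBelow c′ v
  countBelow-cong c≗c′ v = sum-cong N λ j → 𝟙-cong (subst (_< v) (c≗c′ j)) (subst (_< v) (sym (c≗c′ j))) _ _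

  countBelow-split : (c : Fin N → ℕ) → ∀ {y v} → y < v → (∀ j → c j < v → c j ≤ y) →
                     countBelow c v ≡ countBelow c y + ∑[ j < N ] 𝟙 (c j ≟ y)
  countBelow-split c {y} {v} y<v nothing-between = trans
    (sum-cong N λ j → 𝟙<-split y<v (nothing-between j))
    (sum-distrib-+ (λ j → 𝟙 (c j <? y)) (λ j → 𝟙 (c j ≟ y)))

  mult≡∑ : (c : Fin N → ℕ) (x : ℕ) → mult c x ≡ ∑[ j < N ] 𝟙 (c j ≟ x)
  mult≡∑ c x = countBy-allFin N (λ j → c j ≟ x)

  record SameOrder (u w : Fin N → ℕ) : Set where
    field
      preserves-< : ∀ {i j} → u i < u j → w i < w j
      reflects-<  : ∀ {i j} → w i < w j → u i < u j

    preserves-≡ : ∀ {i j} → u i ≡ u j → w i ≡ w j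
    preserves-≡ {i} {j} ui≡uj with <-cmp (w i) (w j)
    ... | tri< wi<wj _ _ = contradiction (reflects-< wi<wj) (<-irrefl ui≡uj)
    ... | tri≈ _ wi≡wj _ = wi≡wj
    ... | tri> _ _ wj<wi = contradiction (reflects-< wj<wi) (<-irrefl (sym ui≡uj))

    reflects-≡ : ∀ {i j} → w i ≡ w j → u i ≡ u j
    reflects-≡ {i} {j} wi≡wj with <-cmp (u i) (u j)
    ... | tri< ui<uj _ _ = contradiction (preserves-< ui<uj) (<-irrefl wi≡wj)
    ... | tri≈ _ ui≡uj _ = ui≡uj
    ... | tri> _ _ uj<ui = contradiction (preserves-< uj<ui) (<-irrefl (sym wi≡wj))

    countBelow-self : ∀ i → countBelow w (w i) ≡ countBelow u (u i)
    countBelow-self i = sum-cong N λ j → 𝟙-cong reflects-< preserves-< _ _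

    resp-HasKernel : ∀ {R} → HasKernel u R → HasKernel w R
    resp-HasKernel K = hasKernel (preserves-≡ ∘ related⇒≡ K) (≡⇒related K ∘ reflects-≡)

  open SameOrder public

  standardize : (Fin N → ℕ) → Fin N → ℕ
  standardize c i = suc (countBelow c (c i))

  module _ (c : Fin N → ℕ) where

    private
      s = standardize c

    standardize-mono : ∀ {i j} → c i ≤ c j → s i ≤ s j
    standardize-mono ci≤cj = s≤s (countBelow-mono c ci≤cj)

    standardize-SameOrder : SameOrder c s
    standardize-SameOrder = record
      { preserves-< = λ {i} {j} ci<cj → s≤s (sum-mono-< N (λ l → 𝟙-mono (λ cl<ci → <-trans cl<ci ci<cj) _ _) i
          (subst₂ _<_ (sym (𝟙-no (c i <? c i) (<-irrefl refl))) (sym (𝟙-yes (c i <? c j) ci<cj)) ≤-refl))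
      ; reflects-<  = λ si<sj → ≰⇒> λ cj≤ci → <⇒≱ si<sj (standardize-mono cj≤ci)
      }

    standardize-≤ : ∀ i → s i ≤ N
    standardize-≤ i = sum-≤1⇒< N (λ j → 𝟙-≤1 (c j <? c i)) i (𝟙-no (c i <? c i) (<-irrefl refl))

    standardize-next : ∀ {i l} → c i < c l → (∀ j → c i < c j → c l ≤ c j) → s l ≡ s i + mult s (s i)
    standardize-next {i} {l} ci<cl least = cong suc (begin
      countBelow c (c l)                              ≡⟨ countBelow-split c ci<cl nothing-between ⟩
      countBelow c (c i) + ∑[ j < N ] 𝟙 (c j ≟ c i)  ≡⟨ cong (countBelow c (c i) +_) mult-s ⟨
      countBelow c (c i) + mult s (s i)               ∎)
      where
      open ≡-Reasoning
      nothing-between : ∀ j → c j < c l → c j ≤ c i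
      nothing-between j cj<cl = ≮⇒≥ λ ci<cj → <⇒≱ cj<cl (least j ci<cj)
      mult-s : mult s (s i) ≡ ∑[ j < N ] 𝟙 (c j ≟ c i)
      mult-s = trans (mult≡∑ s (s i))
        (sum-cong N λ j → 𝟙-cong (reflects-≡ standardize-SameOrder) (preserves-≡ standardize-SameOrder) _ _)

    standardize-IsFubini : 1 ≤ N → IsFubini s
    standardize-IsFubini 1≤N = (λ i → s≤s z≤n) , has-1 , has-next
      where
      has-1 : ∃ λ i → s i ≡ 1
      has-1 with i , _ , least ← minimiser {P = λ _ → ⊤} (λ _ → yes tt) c (fromℕ< 1≤N , tt) =
        i , cong suc (sum-zero N λ j → 𝟙-no (c j <? c i) λ cj<ci → <⇒≱ cj<ci (least j tt))
      has-next : ∀ i → ∃ (λ j → s i < s j) →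
                 ∃ (λ j → s j ≡ s i + mult s (s i)) × (∀ j → s i < s j → s i + mult s (s i) ≤ s j)
      has-next i (j , si<sj)
        with l , ci<cl , least ← minimiser (λ l → c i <? c l) c (j , reflects-< standardize-SameOrder si<sj) =
        (l , next) ,
        λ j′ si<sj′ → subst (_≤ s j′) next (standardize-mono (least j′ (reflects-< standardize-SameOrder si<sj′)))
        where next = standardize-next ci<cl least

  IsFubini-resp-≗ : ∀ {b b′ : Fin N → ℕ} → b ≗ b′ → IsFubini b → IsFubini b′
  IsFubini-resp-≗ {b} {b′} b≗b′ (≥1 , (i₁ , bi₁≡1) , has-next) =
    (λ i → subst (1 ≤_) (b≗b′ i) (≥1 i)) , (i₁ , trans (sym (b≗b′ i₁)) bi₁≡1) , has-next′
    where
    reflect-< : ∀ {i j} → b′ i < b′ j → b i < b j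
    reflect-< {i} {j} = subst₂ _<_ (sym (b≗b′ i)) (sym (b≗b′ j))
    next≡ : ∀ i → b i + mult b (b i) ≡ b′ i + mult b′ (b′ i)
    next≡ i = cong₂ _+_ (b≗b′ i) (begin
      mult b (b i)                ≡⟨ mult≡∑ b (b i) ⟩
      ∑[ j < N ] 𝟙 (b j ≟ b i)    ≡⟨ sum-cong N (λ j → 𝟙-cong (subst₂ _≡_ (b≗b′ j) (b≗b′ i))
                                                            (subst₂ _≡_ (sym (b≗b′ j)) (sym (b≗b′ i))) _ _) ⟩
      ∑[ j < N ] 𝟙 (b′ j ≟ b′ i)  ≡⟨ mult≡∑ b′ (b′ i) ⟨
      mult b′ (b′ i)              ∎)
      where open ≡-Reasoning
    has-next′ : ∀ i → ∃ (λ j → b′ i < b′ j) →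
                ∃ (λ j → b′ j ≡ b′ i + mult b′ (b′ i)) ×
                (∀ j → b′ i < b′ j → b′ i + mult b′ (b′ i) ≤ b′ j)
    has-next′ i (j , b′i<b′j) with (l , bl≡) , least ← has-next i (j , reflect-< b′i<b′j) =
      (l , trans (sym (b≗b′ l)) (trans bl≡ (next≡ i))) ,
      λ j′ b′i<b′j′ → subst₂ _≤_ (next≡ i) (b≗b′ j′) (least j′ (reflect-< b′i<b′j′))

  module _ {b : Fin N → ℕ} (fub : IsFubini b) where

    private
      ≥1       = proj₁ fub
      has-1    = proj₁ (proj₂ fub)
      has-next = proj₂ (proj₂ fub)

    fubini-bottom : ∀ {i} → (∀ j → ¬ b j < b i) → b i ≡ 1
    fubini-bottom {i} nothing-below with i₁ , bi₁≡1 ← has-1 =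
      ≤-antisym (≮⇒≥ λ 1<bi → nothing-below i₁ (subst (_< b i) (sym bi₁≡1) 1<bi)) (≥1 i)

    fubini-next : ∀ {i l} → b l < b i → (∀ j → b j < b i → b j ≤ b l) → b i ≡ b l + mult b (b l)
    fubini-next {i} {l} bl<bi greatest with (l′ , bl′≡) , least ← has-next l (i , bl<bi) =
      ≤-antisym (≮⇒≥ λ bl′<bi → <⇒≱ bl<bl′ (greatest l′ (subst (_< b i) (sym bl′≡) bl′<bi))) (least i bl<bi)
      where
      mult≥1 : 1 ≤ mult b (b l)
      mult≥1 = subst₂ _≤_ (𝟙-yes (b l ≟ b l) refl) (sym (mult≡∑ b (b l))) (term≤sum N (λ j → 𝟙 (b j ≟ b l)) l)
      bl<bl′ : b l < b l′
      bl<bl′ = subst (b l <_) (sym bl′≡) (m<m+n (b l) mult≥1)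

    fubini-standard : b ≗ standardize b
    fubini-standard = WF.All.wfRec (on-wellFounded b <-wellFounded) _ (λ i → b i ≡ standardize b i) step
      where
      step : ∀ i → (∀ {j} → b j < b i → b j ≡ standardize b j) → b i ≡ standardize b i
      step i IH with any? (λ l → b l <? b i)
      ... | no nothing-below = trans (fubini-bottom λ j bj<bi → nothing-below (j , bj<bi))
                                     (cong suc (sym (sum-zero N λ j → 𝟙-no (b j <? b i) λ bj<bi → nothing-below (j , bj<bi))))
      ... | yes below with l , bl<bi , greatest ← maximiser (λ l → b l <? b i) b below = begin
        b i                                                   ≡⟨ fubini-next bl<bi greatest ⟩
        b l + mult b (b l)                                    ≡⟨ cong₂ _+_ (IH bl<bi) (mult≡∑ b (b l)) ⟩
        suc (countBelow b (b l) + ∑[ j < N ] 𝟙 (b j ≟ b l))   ≡⟨ cong suc (countBelow-split b bl<bi greatest) ⟨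
        standardize b i                                       ∎
        where open ≡-Reasoning

unitSteps-identity : (h : ℕ → ℕ) → h 0 ≡ 0 → (∀ v → h (suc v) ≤ suc (h v)) →
                     ∀ k → h k ≡ k → ∀ {v} → v ≤ k → h v ≡ v
unitSteps-identity h h0≡0 step = go
  where
  h≤id : ∀ v → h v ≤ v
  h≤id zero    = ≤-reflexive h0≡0
  h≤id (suc v) = ≤-trans (step v) (s≤s (h≤id v))
  go : ∀ k → h k ≡ k → ∀ {v} → v ≤ k → h v ≡ v
  go zero    hk≡k z≤n = hk≡k
  go (suc k) hk≡k {v} v≤1+k with m≤n⇒m<n∨m≡n v≤1+k
  ... | inj₂ refl      = hk≡k
  ... | inj₁ (s≤s v≤k) = go k (≤-antisym (h≤id k) (s≤s⁻¹ (≤-trans (≤-reflexive (sym hk≡k)) (step k)))) v≤k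

module _ {N : ℕ} {R : Rel N} where

  -- Block minima represent the blocks, so for c with kernel R this counts the values of c below v.
  blocksBelow : (Fin N → ℕ) → ℕ → ℕ
  blocksBelow c v = ∑[ j < N ] (𝟙 (isBlockMin? R j) * 𝟙 (c j <? v))

  denseRank : (Fin N → ℕ) → Fin N → ℕ
  denseRank c i = blocksBelow c (c i)

  denseRank-cong : ∀ {c c′} → c ≗ c′ → denseRank c ≗ denseRank c′
  denseRank-cong c≗c′ i = sum-cong N λ j → cong (𝟙 (isBlockMin? R j) *_)
    (𝟙-cong (subst₂ _<_ (c≗c′ j) (c≗c′ i)) (subst₂ _<_ (sym (c≗c′ j)) (sym (c≗c′ i))) _ _)

  denseRank-resp-SameOrder : ∀ {u w} → SameOrder u w → denseRank w ≗ denseRank u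
  denseRank-resp-SameOrder same i = sum-cong N λ j → cong (𝟙 (isBlockMin? R j) *_)
    (𝟙-cong (reflects-< same) (preserves-< same) _ _)

  blocksBelow-≤ : ∀ c v → blocksBelow c v ≤ numBlocks R
  blocksBelow-≤ c v = ≤-trans
    (sum-mono N λ j → ≤-trans (*-monoʳ-≤ (𝟙 (isBlockMin? R j)) (𝟙-≤1 (c j <? v))) (≤-reflexive (*-identityʳ _)))
    (≤-reflexive (sym (numBlocks≡∑ R)))

  module _ (E : IsEquivRel R) {c : Fin N → ℕ} (K : HasKernel c R) where

    blocksBelow-mono : ∀ {v w} → v ≤ w → blocksBelow c v ≤ blocksBelow c w
    blocksBelow-mono v≤w = sum-mono N λ j →
      *-monoʳ-≤ (𝟙 (isBlockMin? R j)) (𝟙-mono (λ cj<v → <-≤-trans cj<v v≤w) _ _)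

    blocksBelow-strict : ∀ i {v} → c i < v → blocksBelow c (c i) < blocksBelow c v
    blocksBelow-strict i {v} ci<v with m , m-min , Rmi ← blockMin-exists E i =
      sum-mono-< N (λ l → *-monoʳ-≤ (𝟙 (isBlockMin? R l)) (𝟙-mono (λ cl<ci → <-trans cl<ci ci<v) _ _)) m
        (subst₂ _<_ (sym (cong₂ _*_ m-counted (𝟙-no (c m <? c i) (<-irrefl cm≡ci))))
                    (sym (cong₂ _*_ m-counted (𝟙-yes (c m <? v) (subst (_< v) (sym cm≡ci) ci<v))))
                    ≤-refl)
      where
      cm≡ci = related⇒≡ K Rmi
      m-counted = 𝟙-yes (isBlockMin? R m) m-min

    denseRank-SameOrder : SameOrder c (denseRank c)
    denseRank-SameOrder = record
      { preserves-< = λ {i} → blocksBelow-strict i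
      ; reflects-<  = λ ri<rj → ≰⇒> λ cj≤ci → <⇒≱ ri<rj (blocksBelow-mono cj≤ci)
      }

    denseRank-< : ∀ i → denseRank c i < numBlocks R
    denseRank-< i = <-≤-trans (blocksBelow-strict i (n<1+n (c i))) (blocksBelow-≤ c (suc (c i)))

    blocksBelow-suc : ∀ v → blocksBelow c (suc v) ≡ blocksBelow c v + ∑[ j < N ] (𝟙 (isBlockMin? R j) * 𝟙 (c j ≟ v))
    blocksBelow-suc v = trans
      (sum-cong N λ j → trans (cong (𝟙 (isBlockMin? R j) *_) (𝟙<-split (n<1+n v) s≤s⁻¹))
                              (*-distribˡ-+ (𝟙 (isBlockMin? R j)) (𝟙 (c j <? v)) (𝟙 (c j ≟ v))))
      (sum-distrib-+ (λ j → 𝟙 (isBlockMin? R j) * 𝟙 (c j <? v)) (λ j → 𝟙 (isBlockMin? R j) * 𝟙 (c j ≟ v)))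

    blockMins-with-value≤1 : ∀ v → ∑[ j < N ] (𝟙 (isBlockMin? R j) * 𝟙 (c j ≟ v)) ≤ 1
    blockMins-with-value≤1 v = subst (_≤ 1) (sum-cong N λ j → 𝟙-× (isBlockMin? R j) (c j ≟ v))
      (sum-𝟙-atMostOne N (λ j → isBlockMin? R j ×-dec c j ≟ v) λ i j (i-min , ci≡v) (j-min , cj≡v) →
        blockMin-unique E i-min j-min (≡⇒related K (trans ci≡v (sym cj≡v))))

    -- blocksBelow c grows by at most one per step, yet reaches numBlocks R at numBlocks R.
    blocksBelow-identity : (∀ j → c j < numBlocks R) → ∀ {v} → v ≤ numBlocks R → blocksBelow c v ≡ v
    blocksBelow-identity bounded = unitSteps-identity (blocksBelow c) none step (numBlocks R) all
      where
      none : blocksBelow c 0 ≡ 0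
      none = sum-zero N λ j → trans (cong (𝟙 (isBlockMin? R j) *_) (𝟙-no (c j <? 0) λ ())) (*-zeroʳ (𝟙 (isBlockMin? R j)))
      step : ∀ v → blocksBelow c (suc v) ≤ suc (blocksBelow c v)
      step v = subst (blocksBelow c (suc v) ≤_) (+-comm _ 1)
        (subst (_≤ blocksBelow c v + 1) (sym (blocksBelow-suc v)) (+-monoʳ-≤ (blocksBelow c v) (blockMins-with-value≤1 v)))
      all : blocksBelow c (numBlocks R) ≡ numBlocks R
      all = trans (sum-cong N λ j → trans (cong (𝟙 (isBlockMin? R j) *_) (𝟙-yes (c j <? numBlocks R) (bounded j)))
                                          (*-identityʳ _))
                  (sym (numBlocks≡∑ R))

module _ {N : ℕ} {R : Rel N} (E : IsEquivRel R) where

  private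
    k = numBlocks R

  FubiniWithKernel : (Fin N → ℕ) → Set
  FubiniWithKernel b = IsFubini b × HasKernel b R

  BoundedWithKernel : (Fin N → ℕ) → Set
  BoundedWithKernel c = HasKernel c R × (∀ i → c i < k)

  fubini↔bounded : 1 ≤ N → ≗-Bijection FubiniWithKernel BoundedWithKernel (map suc (upTo N)) (upTo k)
  fubini↔bounded 1≤N = record
    { to        = denseRank {R = R}
    ; from      = standardize
    ; to-cong   = denseRank-cong
    ; from-cong = λ {c} {c′} c≗c′ i → cong suc (trans (countBelow-cong c≗c′ (c i)) (cong (countBelow c′) (c≗c′ i)))
    ; P-resp    = λ b≗b′ (fub , K) → IsFubini-resp-≗ b≗b′ fub , HasKernel-resp-≗ b≗b′ K
    ; Q-resp    = λ c≗c′ (K , bounded) → HasKernel-resp-≗ c≗c′ K , λ i → subst (_< k) (c≗c′ i) (bounded i)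
    ; to-Q      = λ (_ , K) → resp-HasKernel (denseRank-SameOrder E K) K , denseRank-< E K
    ; from-P    = λ {c} (K , _) → standardize-IsFubini c 1≤N , resp-HasKernel (standardize-SameOrder c) K
    ; to-∈      = λ (_ , K) i → ∈-upTo⁺ (denseRank-< E K i)
    ; from-∈    = λ {c} _ i → ∈-map⁺ suc (∈-upTo⁺ (standardize-≤ c i))
    ; from-to   = λ (fub , K) i → trans (cong suc (countBelow-self (denseRank-SameOrder E K) i)) (sym (fubini-standard fub i))
    ; to-from   = λ {c} (K , bounded) i →
                    trans (denseRank-resp-SameOrder (standardize-SameOrder c) i) (blocksBelow-identity E K bounded (<⇒≤ (bounded i)))
    }

  ∑-fubini-HasKernel : 1 ≤ N → ∑[ b ∈ allTuples N ] 𝟙 (isFubini? b ×-dec HasKernel? b R) ≡ k !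
  ∑-fubini-HasKernel 1≤N = begin
    ∑[ b ∈ allTuples N ] 𝟙 (isFubini? b ×-dec HasKernel? b R)
      ≡⟨ ∑-allFuns-≗-Bijection (Unique.map⁺ suc-injective (Unique.upTo⁺ N)) (Unique.upTo⁺ k) (fubini↔bounded 1≤N)
                               (λ b → isFubini? b ×-dec HasKernel? b R) bounded? ⟩
    ∑[ c ∈ allFuns N (upTo k) ] 𝟙 (bounded? c)
      ≡⟨ ∑-cong-All (allFuns-∈ N (upTo k)) (λ c∈ → 𝟙-cong proj₁ (λ K → K , λ i → ∈-upTo⁻ (c∈ i)) _ _) ⟩
    ∑[ c ∈ allFuns N (upTo k) ] 𝟙 (HasKernel? c R)
      ≡⟨ kernelCount N E (Unique.upTo⁺ k) ⟩
    fallingFactorial (length (upTo k)) k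
      ≡⟨ cong (λ m → fallingFactorial m k) (length-upTo k) ⟩
    fallingFactorial k k
      ≡⟨ fallingFactorial-n-n k ⟩
    k ! ∎
    where
    open ≡-Reasoning
    bounded? : ∀ c → Dec (BoundedWithKernel c)
    bounded? c = HasKernel? c R ×-dec all? λ i → c i <? k

FirstInDistinctBlocks : (r : ℕ) {N : ℕ} → Rel N → Set
FirstInDistinctBlocks r {N} R = (a b : Fin N) → toℕ a < r → toℕ b < r → R a b ≡ true → a ≡ b

IsRRelation : (r : ℕ) {N : ℕ} → Rel N → Set
IsRRelation r R = IsEquivRel R × FirstInDistinctBlocks r R

isRRelation? : (r : ℕ) {N : ℕ} (R : Rel N) → Dec (IsRRelation r R)
isRRelation? r R = isEquivRel? R ×-dec
  all? λ a → all? λ b → (toℕ a <? r) →-dec ((toℕ b <? r) →-dec ((R a b ≟B true) →-dec (a ≟F b)))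

numBlocks-≥ : {N r : ℕ} {R : Rel N} → r ≤ N → FirstInDistinctBlocks r R → r ≤ numBlocks R
numBlocks-≥ {N} {r} {R} r≤N distinct = begin
  r                                ≡⟨ sum-𝟙-toℕ< N r r≤N ⟨
  ∑[ i < N ] 𝟙 (toℕ i <? r)        ≤⟨ sum-mono N (λ i → 𝟙-mono first-is-min (toℕ i <? r) (isBlockMin? R i)) ⟩
  ∑[ i < N ] 𝟙 (isBlockMin? R i)   ≡⟨ numBlocks≡∑ R ⟨
  numBlocks R                      ∎
  where
  open ≤-Reasoning
  first-is-min : ∀ {i} → toℕ i < r → IsBlockMin R i
  first-is-min {i} i<r l Rli = ≮⇒≥ λ l<i → <-irrefl (cong toℕ (distinct l i (<-trans l<i i<r) i<r Rli)) l<i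

module _ (n r : ℕ) where

  private
    N = n + r

  𝟙-isRFubini : ∀ b → 𝟙 (isRFubini? n r b) ≡
                      ∑[ R ∈ allRels N ] (𝟙 (isRRelation? r R) * 𝟙 (isFubini? b ×-dec HasKernel? b R))
  𝟙-isRFubini b = begin
    𝟙 (isRFubini? n r b)
      ≡⟨ *-identityʳ (𝟙 (isRFubini? n r b)) ⟨
    𝟙 (isRFubini? n r b) * 1
      ≡⟨ cong (𝟙 (isRFubini? n r b) *_) (∑-allRels-HasKernel b) ⟨
    𝟙 (isRFubini? n r b) * ∑[ R ∈ allRels N ] 𝟙 (HasKernel? b R)
      ≡⟨ ∑-*ˡ (allRels N) (𝟙 (isRFubini? n r b)) (λ R → 𝟙 (HasKernel? b R)) ⟨
    ∑[ R ∈ allRels N ] (𝟙 (isRFubini? n r b) * 𝟙 (HasKernel? b R))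
      ≡⟨ ∑-cong (allRels N) (λ R → trans (sym (𝟙-× (isRFubini? n r b) (HasKernel? b R)))
                                         (𝟙-⇔-× to from (isRFubini? n r b ×-dec HasKernel? b R)
                                                (isRRelation? r R) (isFubini? b ×-dec HasKernel? b R))) ⟩
    ∑[ R ∈ allRels N ] (𝟙 (isRRelation? r R) * 𝟙 (isFubini? b ×-dec HasKernel? b R)) ∎
    where
    open ≡-Reasoning
    to : ∀ {R} → IsRFubini n r b × HasKernel b R → IsRRelation r R × (IsFubini b × HasKernel b R)
    to ((fub , distinct) , K) =
      (kernel-isEquivRel K , λ i j i<r j<r Rij → distinct i j i<r j<r (related⇒≡ K Rij)) , fub , K
    from : ∀ {R} → IsRRelation r R × (IsFubini b × HasKernel b R) → IsRFubini n r b × HasKernel b R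
    from ((_ , distinct) , fub , K) = (fub , λ i j i<r j<r bi≡bj → distinct i j i<r j<r (≡⇒related K bi≡bj)) , K

  numRFubini≡∑rRelations : 1 ≤ r → numRFubini n r ≡ ∑[ R ∈ allRels N ] (𝟙 (isRRelation? r R) * numBlocks R !)
  numRFubini≡∑rRelations 1≤r = begin
    numRFubini n r
      ≡⟨ countBy≡∑𝟙 (isRFubini? n r) (allTuples N) ⟩
    ∑[ b ∈ allTuples N ] 𝟙 (isRFubini? n r b)
      ≡⟨ ∑-cong (allTuples N) 𝟙-isRFubini ⟩
    ∑[ b ∈ allTuples N ] ∑[ R ∈ allRels N ] (𝟙 (isRRelation? r R) * 𝟙 (isFubini? b ×-dec HasKernel? b R))
      ≡⟨ ∑-comm (allTuples N) (allRels N) _ ⟩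
    ∑[ R ∈ allRels N ] ∑[ b ∈ allTuples N ] (𝟙 (isRRelation? r R) * 𝟙 (isFubini? b ×-dec HasKernel? b R))
      ≡⟨ ∑-cong (allRels N) (λ R → trans
           (∑-*ˡ (allTuples N) (𝟙 (isRRelation? r R)) λ b → 𝟙 (isFubini? b ×-dec HasKernel? b R))
           (fiber R (isRRelation? r R))) ⟩
    ∑[ R ∈ allRels N ] (𝟙 (isRRelation? r R) * numBlocks R !) ∎
    where
    open ≡-Reasoning
    fiber : ∀ R (d : Dec (IsRRelation r R)) →
            𝟙 d * ∑[ b ∈ allTuples N ] 𝟙 (isFubini? b ×-dec HasKernel? b R) ≡ 𝟙 d * numBlocks R !
    fiber R (yes (E , _)) = cong (1 *_) (∑-fubini-HasKernel E (≤-trans 1≤r (m≤n+m r n)))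
    fiber R (no _)        = refl

  sumUpTo-rPartitions : ∀ R (d : Dec (IsRRelation r R)) →
                        sumUpTo n (λ k → (k + r) ! * 𝟙 (isRPartition? n r (k + r) R)) ≡ 𝟙 d * numBlocks R !
  sumUpTo-rPartitions R (no ¬rrel) = sumUpTo-zero n λ k _ →
    trans (cong ((k + r) ! *_) (𝟙-no (isRPartition? n r (k + r) R) λ (E , _ , distinct) → ¬rrel (E , distinct)))
          (*-zeroʳ ((k + r) !))
  sumUpTo-rPartitions R (yes (E , distinct)) = begin
    sumUpTo n (λ k → (k + r) ! * 𝟙 (isRPartition? n r (k + r) R))
      ≡⟨ sumUpTo-cong n (λ k → cong ((k + r) ! *_) (𝟙-cong
           (λ (_ , b≡k+r , _) → +-cancelʳ-≡ r k d (trans (sym b≡k+r) (sym d+r≡b)))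
           (λ k≡d → E , trans (sym d+r≡b) (cong (_+ r) (sym k≡d)) , distinct) _ (k ≟ d))) ⟩
    sumUpTo n (λ k → (k + r) ! * 𝟙 (k ≟ d))
      ≡⟨ sumUpTo-select n d≤n (λ k → (k + r) !) ⟩
    (d + r) !
      ≡⟨ cong _! d+r≡b ⟩
    numBlocks R !
      ≡⟨ +-identityʳ _ ⟨
    1 * numBlocks R ! ∎
    where
    open ≡-Reasoning
    d = numBlocks R ∸ r
    d+r≡b : d + r ≡ numBlocks R
    d+r≡b = m∸n+n≡m (numBlocks-≥ (m≤n+m r n) distinct)
    d≤n : d ≤ n
    d≤n = +-cancelʳ-≤ r d n (≤-trans (≤-reflexive d+r≡b) (numBlocks-≤ R))

  Fub≡∑rRelations : Fub n r ≡ ∑[ R ∈ allRels N ] (𝟙 (isRRelation? r R) * numBlocks R !)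
  Fub≡∑rRelations = begin
    sumUpTo n (λ k → (k + r) ! * rStirling2 n r k)
      ≡⟨ sumUpTo-cong n (λ k → cong ((k + r) ! *_) (countBy≡∑𝟙 (isRPartition? n r (k + r)) (allRels N))) ⟩
    sumUpTo n (λ k → (k + r) ! * ∑[ R ∈ allRels N ] 𝟙 (isRPartition? n r (k + r) R))
      ≡⟨ sumUpTo-cong n (λ k → sym (∑-*ˡ (allRels N) ((k + r) !) _)) ⟩
    sumUpTo n (λ k → ∑[ R ∈ allRels N ] ((k + r) ! * 𝟙 (isRPartition? n r (k + r) R)))
      ≡⟨ sumUpTo-∑-comm n (allRels N) _ ⟩
    ∑[ R ∈ allRels N ] sumUpTo n (λ k → (k + r) ! * 𝟙 (isRPartition? n r (k + r) R))
      ≡⟨ ∑-cong (allRels N) (λ R → sumUpTo-rPartitions R (isRRelation? r R)) ⟩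
    ∑[ R ∈ allRels N ] (𝟙 (isRRelation? r R) * numBlocks R !) ∎
    where open ≡-Reasoning

corollary3p7 : (r n : ℕ) → 1 ≤ r → numRFubini n r ≡ Fub n r
corollary3p7 r n 1≤r = trans (numRFubini≡∑rRelations n r 1≤r) (sym (Fub≡∑rRelations n r))
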